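{- Let $\mathcal V$ be a unital commutative quantale, $F,T\colon\mathsf{Set}\to\mathsf{Set}$ functors, $\zeta\colon T\circ F\Rightarrow F\circ T$ a natural transformation, and $\hat F,\hat T$ liftings of $F,T$ to $\mathcal V\text{ - }\mathsf{Pred}$ with Wasserstein liftings $\bar F,\bar T$ to $\mathcal V\text{ - }\mathsf{Rel}$. Assume that $\zeta$ lifts to a natural transformation $\hat\zeta\colon\hat T\circ\hat F\Rightarrow\hat F\circ\hat T$, and that for every set $X$ and every predicate $p$ on $F(X\times X)$ we have $\hat T\big((\lambda^F_X)_*(p)\big)\le (T\lambda^F_X)_*\big(\hat T(p)\big)$. Then $\zeta$ lifts to a natural transformation $\bar\zeta\colon\bar T\circ\bar F\Rightarrow\bar F\circ\bar T$.
   Context: A unital commutative quantale $\mathcal V$ is a complete lattice $(\mathcal V,\le)$ with an associative, commutative operation $\otimes$ distributing over arbitrary joins $\bigvee$, with unit $1$. $\mathcal V\text{ - }\mathsf{Pred}$ has objects $p\colon X\to\mathcal V$ and morphisms $f\colon X\to Y$ from $p$ to $q$ with $p\le q\circ f$; $\mathcal V\text{ - }\mathsf{Rel}$ has objects $r\colon X\times X\to\mathcal V$ and morphisms $f$ from $r$ to $q$ with $r\le q\circ(f\times f)$. For $f\colon X\to Y$ and $p\colon X\to\mathcal V$, the direct image is $f_*(p)(y)=\bigvee\{p(x)\mid f(x)=y\}$. A lifting of $F$ to $\mathcal V\text{ - }\mathsf{Pred}$ is a functor sending predicates on $X$ to predicates on $FX$ and morphisms $f$ to $Ff$. The Wasserstein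 lifting of $\hat F$ sends $r\colon X\times X\to\mathcal V$ to $\bar F(r)(t_1,t_2)=\bigvee\{\hat F(r)(t)\mid t\in F(X\times X), F\pi_1(t)=t_1,F\pi_2(t)=t_2\}$ (with $r$ viewed as predicate on $X\times X$) and $f$ to $Ff$. $\lambda^F_X=\langle F\pi_1,F\pi_2\rangle\colon F(X\times X)\to FX\times FX$. A natural transformation $\zeta\colon TF\Rightarrow FT$ lifts to $\hat\zeta\colon\hat T\hat F\Rightarrow\hat F\hat T$ if $\hat T(\hat F(p))\le\hat F(\hat T(p))\circ\zeta_X$ for all predicates $p$ on any $X$; it lifts to $\bar\zeta\colon\bar T\bar F\Rightarrow\bar F\bar T$ if $\bar T(\bar F(r))\le\bar F(\bar T(r))\circ(\zeta_X\times\zeta_X)$ for all relations $r$ on any $X$. -}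

module Defs where

open import Level using (0ℓ)
open import Data.Product using (Σ; _×_; _,_; proj₁; proj₂; <_,_>)
open import Relation.Binary.PropositionalEquality using (_≡_)
open import Function using (_∘_; id)

record Quantale : Set₁ where
  infix 4 _≤_
  infixr 7 _⊗_
  field
    Carrier   : Set
    _≤_       : Carrier → Carrier → Set
    ≤-refl    : ∀ {a} → a ≤ a
    ≤-trans   : ∀ {a b c} → a ≤ b → b ≤ c → a ≤ c
    ≤-antisym : ∀ {a b} → a ≤ b → b ≤ a → a ≡ b
    ⋁         : {I : Set} → (I → Carrier) → Carrier
    ⋁-upper   : {I : Set} (f : I → Carrier) (i : I) → f i ≤ ⋁ f
    ⋁-least   : {I : Set} (f : I → Carrier) (b : Carrier) →
                (∀ i → f i ≤ b) → ⋁ f ≤ b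
    _⊗_       : Carrier → Carrier → Carrier
    𝟙         : Carrier
    ⊗-assoc   : ∀ a b c → (a ⊗ b) ⊗ c ≡ a ⊗ (b ⊗ c)
    ⊗-comm    : ∀ a b → a ⊗ b ≡ b ⊗ a
    ⊗-unitˡ   : ∀ a → 𝟙 ⊗ a ≡ a
    ⊗-distrib-⋁ : ∀ a {I : Set} (f : I → Carrier) → a ⊗ ⋁ f ≡ ⋁ (λ i → a ⊗ f i)

record Functor : Set₁ where
  field
    F₀     : Set → Set
    fmap   : {X Y : Set} → (X → Y) → F₀ X → F₀ Y
    fmap-id : {X : Set} (t : F₀ X) → fmap id t ≡ t
    fmap-∘  : {X Y Z : Set} (g : Y → Z) (f : X → Y) (t : F₀ X) →
              fmap (g ∘ f) t ≡ fmap g (fmap f t)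
open Functor public

record DistLaw (T F : Functor) : Set₁ where
  field
    ζ   : {X : Set} → F₀ T (F₀ F X) → F₀ F (F₀ T X)
    nat : {X Y : Set} (f : X → Y) (t : F₀ T (F₀ F X)) →
          ζ (fmap T (fmap F f) t) ≡ fmap F (fmap T f) (ζ t)
open DistLaw public

module _ (𝒱 : Quantale) where
  open Quantale 𝒱

  Pred : Set → Set
  Pred X = X → Carrier

  Rel : Set → Set
  Rel X = X × X → Carrier

  -- a lifting of F to V-Pred: a predicate transformer that is functorial,
  -- i.e. sends V-Pred morphisms f : p → q (p ≤ q ∘ f) to morphisms F f : F̂ p → F̂ q
  record PredLifting (F : Functor) : Set₁ where
    field
      lift : {X : Set} → Pred X → Pred (F₀ F X)
      lift-mor : {X Y : Set} (f : X → Y) (p : Pred X) (q : Pred Y) →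
                 (∀ x → p x ≤ q (f x)) →
                 ∀ t → lift p t ≤ lift q (fmap F f t)
  open PredLifting public

  direct-image : {X Y : Set} → (X → Y) → Pred X → Pred Y
  direct-image {X} f p y = ⋁ {Σ X (λ x → f x ≡ y)} (λ s → p (proj₁ s))

  λF : (F : Functor) (X : Set) → F₀ F (X × X) → F₀ F X × F₀ F X
  λF F X = < fmap F proj₁ , fmap F proj₂ >

  wasserstein : {F : Functor} → PredLifting F → {X : Set} → Rel X → Rel (F₀ F X)
  wasserstein {F} Fh {X} r (t₁ , t₂) =
    ⋁ {Σ (F₀ F (X × X)) (λ t → (fmap F proj₁ t ≡ t₁) × (fmap F proj₂ t ≡ t₂))}
      (λ s → lift Fh r (proj₁ s))

-- The Wasserstein lifting W_G r of a relation r is the direct image of Ĝ r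
-- along λ^G, and conversely Ĝ r ≤ W_G r ∘ λ^G. So a summand T̂(W_F r)(w) of
-- W_T(W_F r)(u, v) is bounded by T̂((λ^F)_* (F̂ r))(w), which the hypothesis
-- on λ^F bounds by the summands T̂ F̂ r (s) with T λ^F s = w. Each of these is
-- at most F̂ T̂ r (ζ s) by ζ̂, hence at most W_F(W_T r) at λ^F (F λ^T (ζ s)),
-- and naturality of ζ identifies that pair with (ζ u, ζ v).
module Submission where

open import Defs
open import Data.Product using (_×_; _,_; proj₁; proj₂)
open import Data.Product.Properties using (×-≡,≡→≡)
open import Relation.Binary.PropositionalEquality
open import Relation.Binary.Structures using (IsPreorder)
open import Function using (id; _∘_)
import Relation.Binary.Reasoning.Base.Double

module _ {𝒱 : Quantale} where
  open Quantale 𝒱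

  ≤-reflexive : {a b : Carrier} → a ≡ b → a ≤ b
  ≤-reflexive refl = ≤-refl

  ≤-isPreorder : IsPreorder _≡_ _≤_
  ≤-isPreorder = record
    { isEquivalence = isEquivalence
    ; reflexive     = ≤-reflexive
    ; trans         = ≤-trans
    }

  module ≤-Reasoning = Relation.Binary.Reasoning.Base.Double ≤-isPreorder

  lift-mono : {G : Functor} (L : PredLifting 𝒱 G) {X : Set} {p q : Pred 𝒱 X} →
              (∀ x → p x ≤ q x) → ∀ t → lift L p t ≤ lift L q t
  lift-mono {G} L {p = p} {q} p≤q t =
    ≤-trans (lift-mor L id p q p≤q t)
            (≤-reflexive (cong (lift L q) (fmap-id G t)))

  wasserstein≤direct-image : {G : Functor} (L : PredLifting 𝒱 G) {X : Set}
    (r : Rel 𝒱 X) (t : F₀ G X × F₀ G X) →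
    wasserstein 𝒱 L r t ≤ direct-image 𝒱 (λF 𝒱 G X) (lift L r) t
  wasserstein≤direct-image L r _ =
    ⋁-least _ _ λ { (t , refl , refl) → ⋁-upper _ (t , refl) }

  lift≤wasserstein : {G : Functor} (L : PredLifting 𝒱 G) {X : Set}
    (r : Rel 𝒱 X) (t : F₀ G (X × X)) →
    lift L r t ≤ wasserstein 𝒱 L r (λF 𝒱 G X t)
  lift≤wasserstein L r t = ⋁-upper _ (t , refl , refl)

  lift²≤wasserstein² : {G H : Functor} (L : PredLifting 𝒱 G) (M : PredLifting 𝒱 H)
    {X : Set} (r : Rel 𝒱 X) (t : F₀ G (F₀ H (X × X))) →
    lift L (lift M r) t ≤
    wasserstein 𝒱 L (wasserstein 𝒱 M r) (λF 𝒱 G (F₀ H X) (fmap G (λF 𝒱 H X) t))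
  lift²≤wasserstein² {G} {H} L M {X} r t =
    ≤-trans (lift-mor L (λF 𝒱 H X) (lift M r) (wasserstein 𝒱 M r)
                      (lift≤wasserstein M r) t)
            (lift≤wasserstein L (wasserstein 𝒱 M r) (fmap G (λF 𝒱 H X) t))

  λ-ζ-commute : {F T : Functor} (ζ′ : DistLaw T F) {X : Set}
    (s : F₀ T (F₀ F (X × X))) →
    λF 𝒱 F (F₀ T X) (fmap F (λF 𝒱 T X) (ζ ζ′ s)) ≡
    (ζ ζ′ (fmap T proj₁ (fmap T (λF 𝒱 F X) s)) ,
     ζ ζ′ (fmap T proj₂ (fmap T (λF 𝒱 F X) s)))
  λ-ζ-commute {F} {T} ζ′ {X} s =
    ×-≡,≡→≡ (coordinate proj₁ refl refl , coordinate proj₂ refl refl)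
    where
    λT : F₀ T (X × X) → F₀ T X × F₀ T X
    λT = λF 𝒱 T X
    λF′ : F₀ F (X × X) → F₀ F X × F₀ F X
    λF′ = λF 𝒱 F X
    -- One proof for both coordinates: for the projections both hypotheses are refl.
    coordinate : (π : X × X → X) {σ : F₀ T X × F₀ T X → F₀ T X}
      {τ : F₀ F X × F₀ F X → F₀ F X} → σ ∘ λT ≡ fmap T π → τ ∘ λF′ ≡ fmap F π →
      fmap F σ (fmap F λT (ζ ζ′ s)) ≡ ζ ζ′ (fmap T τ (fmap T λF′ s))
    coordinate π {σ} {τ} σ∘λT≡Tπ τ∘λF≡Fπ = begin
      fmap F σ (fmap F λT (ζ ζ′ s))   ≡⟨ fmap-∘ F σ λT (ζ ζ′ s) ⟨
      fmap F (σ ∘ λT) (ζ ζ′ s)        ≡⟨ cong (λ f → fmap F f (ζ ζ′ s)) σ∘λT≡Tπ ⟩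
      fmap F (fmap T π) (ζ ζ′ s)      ≡⟨ nat ζ′ π s ⟨
      ζ ζ′ (fmap T (fmap F π) s)      ≡⟨ cong (λ f → ζ ζ′ (fmap T f s)) τ∘λF≡Fπ ⟨
      ζ ζ′ (fmap T (τ ∘ λF′) s)       ≡⟨ cong (ζ ζ′) (fmap-∘ T τ λF′ s) ⟩
      ζ ζ′ (fmap T τ (fmap T λF′ s))  ∎
      where open ≡-Reasoning

theorem27 : (𝒱 : Quantale) (F T : Functor) (ζ′ : DistLaw T F)
    (Fh : PredLifting 𝒱 F) (Th : PredLifting 𝒱 T) →
    -- ζ lifts to ζ̂ : T̂ F̂ ⇒ F̂ T̂
    (∀ {X : Set} (p : Pred 𝒱 X) (t : F₀ T (F₀ F X)) →
      Quantale._≤_ 𝒱 (lift Th (lift Fh p) t) (lift Fh (lift Th p) (ζ ζ′ t))) →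
    -- T̂ ((λ^F_X)_* p) ≤ (T λ^F_X)_* (T̂ p)
    (∀ {X : Set} (p : Pred 𝒱 (F₀ F (X × X))) (s : F₀ T (F₀ F X × F₀ F X)) →
      Quantale._≤_ 𝒱 (lift Th (direct-image 𝒱 (λF 𝒱 F X) p) s)
                     (direct-image 𝒱 (fmap T (λF 𝒱 F X)) (lift Th p) s)) →
    -- ζ lifts to ζ̄ : T̄ F̄ ⇒ F̄ T̄
    (∀ {X : Set} (r : Rel 𝒱 X) (u v : F₀ T (F₀ F X)) →
      Quantale._≤_ 𝒱 (wasserstein 𝒱 Th (wasserstein 𝒱 Fh r) (u , v))
                     (wasserstein 𝒱 Fh (wasserstein 𝒱 Th r) (ζ ζ′ u , ζ ζ′ v)))
theorem27 𝒱 F T ζ′ Fh Th ζ̂ T̂-λ {X} r _ _ =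
  ⋁-least _ _ λ { (w , refl , refl) → begin
    lift Th (wasserstein 𝒱 Fh r) w
      ≲⟨ lift-mono Th (wasserstein≤direct-image Fh r) w ⟩
    lift Th (direct-image 𝒱 (λF 𝒱 F X) (lift Fh r)) w
      ≲⟨ T̂-λ (lift Fh r) w ⟩
    direct-image 𝒱 (fmap T (λF 𝒱 F X)) (lift Th (lift Fh r)) w
      ≲⟨ ⋁-least _ _ (λ { (s , refl) → summand-bound s }) ⟩
    wasserstein 𝒱 Fh (wasserstein 𝒱 Th r) (ζ ζ′ (fmap T proj₁ w) , ζ ζ′ (fmap T proj₂ w)) ∎ }
  where
  open Quantale 𝒱
  open ≤-Reasoning {𝒱}
  summand-bound : (s : F₀ T (F₀ F (X × X))) → lift Th (lift Fh r) s ≤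
    wasserstein 𝒱 Fh (wasserstein 𝒱 Th r)
      (ζ ζ′ (fmap T proj₁ (fmap T (λF 𝒱 F X) s)) , ζ ζ′ (fmap T proj₂ (fmap T (λF 𝒱 F X) s)))
  summand-bound s = begin
    lift Th (lift Fh r) s
      ≲⟨ ζ̂ r s ⟩
    lift Fh (lift Th r) (ζ ζ′ s)
      ≲⟨ lift²≤wasserstein² Fh Th r (ζ ζ′ s) ⟩
    wasserstein 𝒱 Fh (wasserstein 𝒱 Th r) (λF 𝒱 F (F₀ T X) (fmap F (λF 𝒱 T X) (ζ ζ′ s)))
      ≡⟨ cong (wasserstein 𝒱 Fh (wasserstein 𝒱 Th r)) (λ-ζ-commute {𝒱} ζ′ s) ⟩
    wasserstein 𝒱 Fh (wasserstein 𝒱 Th r)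
      (ζ ζ′ (fmap T proj₁ (fmap T (λF 𝒱 F X) s)) , ζ ζ′ (fmap T proj₂ (fmap T (λF 𝒱 F X) s))) ∎
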